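{- Let $A\in\mathbb{Z}^{m\times d}$ with $\ker_{\mathbb{Z}}(A)\cap\mathbb{N}^d=\{0\}$ and let $(b_i)_{i\in\mathbb{N}}$ be a sequence in $\mathbb{N}A$ such that there exist $r\in\mathbb{N}$, $C>0$ and $i_0$ with $\|b_i\|\le C\cdot i^r$ for all $i\ge i_0$. Then $(b_i)_{i\in\mathbb{N}}$ has a meaningful parametrization, i.e. there is a polynomial $q\in\mathbb{Q}[t]$ with $|\mathcal{F}_{A,b_i}|\le q(i)$ for all $i\in\mathbb{N}$.
   Context: $\mathbb{N}A$ is the affine semigroup generated by the columns of $A$; $\mathcal{F}_{A,b}=\{u\in\mathbb{N}^d:Au=b\}$. -}

module Defs where

open import Data.Nat using (ℕ; zero; suc)
open import Data.Integer as ℤ using (ℤ; +_)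
open import Data.Fin using (Fin; zero; suc)
open import Data.Vec using (Vec; lookup)
open import Data.List using (List; []; _∷_)
open import Data.Rational as ℚ using (ℚ; 0ℚ; _/_)
open import Relation.Binary.PropositionalEquality using (_≡_)
open import Data.Product using (∃)

-- integer matrices A ∈ ℤ^{m×d}, indexed A i j (row i, column j)
Matrix : ℕ → ℕ → Set
Matrix m d = Fin m → Fin d → ℤ

sumℤ : ∀ {n} → (Fin n → ℤ) → ℤ
sumℤ {zero} f = + 0
sumℤ {suc n} f = f zero ℤ.+ sumℤ (λ j → f (suc j))

_·_ : ∀ {m d} → Matrix m d → Vec ℕ d → Fin m → ℤ
(A · u) i = sumℤ (λ j → A i j ℤ.* (+ lookup u j))

PointedKernel : ∀ {m d} → Matrix m d → Set
PointedKernel {m} {d} A =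
  (u : Vec ℕ d) → (∀ i → (A · u) i ≡ + 0) → ∀ j → lookup u j ≡ 0

InSemigroup : ∀ {m d} → Matrix m d → (Fin m → ℤ) → Set
InSemigroup {d = d} A b = ∃ λ (u : Vec ℕ d) → ∀ i → (A · u) i ≡ b i

InFiber : ∀ {m d} → Matrix m d → (Fin m → ℤ) → Vec ℕ d → Set
InFiber A b u = ∀ i → (A · u) i ≡ b i

-- polynomials in ℚ[t] as coefficient lists (constant term first)
Poly : Set
Poly = List ℚ

ℕ→ℚ : ℕ → ℚ
ℕ→ℚ n = (+ n) / 1

eval : Poly → ℚ → ℚ
eval [] x = 0ℚ
eval (c ∷ cs) x = c ℚ.+ x ℚ.* eval cs x

module Submission where

-- Pointedness of the kernel means that no nontrivial nonnegative combination of the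
-- columns A₁,…,A_d vanishes; a Gordan-type separation theorem then provides y ∈ ℤ^m with
-- y·Aⱼ ≥ 1 for every column.  For u ∈ F_{A,b} this gives uⱼ ≤ Σⱼ uⱼ (y·Aⱼ) = y·b ≤ Y·B, where
-- Y = Σₖ |yₖ| and B bounds the |bₖ|.  Since |bᵢₖ| ≤ C·iʳ + M for all i, the fiber F_{A,bᵢ}
-- lies in the box [0, Y(C·iʳ + M)]^d, so it has at most (1 + Y(C·iʳ + M))^d ≤ K·(1 + i)^{rd}
-- elements, and K·(1 + t)^{rd} is the required polynomial.

open import Defs

module FiniteSums where

  open import Data.Nat as ℕ using (ℕ; zero; suc)
  import Data.Nat.Properties as ℕP
  open import Data.Integer using (ℤ; +_; -[1+_]; 0ℤ; _+_; _≤_; _<_; ∣_∣; +<+; -≤+)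
  open import Data.Integer.Properties
    using (+-mono-≤; ≤-refl; ≤-trans; ≤-<-trans; i≤i+j; i≤j+i; pos-+)
  open import Data.Integer.Base using (nonNegative)
  open import Data.Fin using (Fin; zero; suc)
  open import Function using (_∘_)
  open import Data.Product using (∃; _,_)
  open import Relation.Binary.PropositionalEquality using (_≡_; refl; trans; cong; subst)

  open import Algebra.Properties.Semiring.Sum Data.Integer.Properties.+-*-semiring public
    using (sum; sum-cong-≗; ∑-distrib-+; ∑-comm; *-distribˡ-sum; *-distribʳ-sum; sum-replicate-zero)
  open import Algebra.Properties.Semiring.Sum ℕP.+-*-semiring public
    using () renaming (sum to sumℕ; *-distribʳ-sum to *-distribʳ-sumℕ)

  sumℤ≡sum : ∀ {n} (f : Fin n → ℤ) → sumℤ f ≡ sum f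
  sumℤ≡sum {zero} f = refl
  sumℤ≡sum {suc n} f = cong (λ s → f zero + s) (sumℤ≡sum (f ∘ suc))

  +-sumℕ : ∀ {n} (f : Fin n → ℕ) → + sumℕ f ≡ sum (λ j → + f j)
  +-sumℕ {zero} f = refl
  +-sumℕ {suc n} f = trans (pos-+ (f zero) _) (cong (λ s → + f zero + s) (+-sumℕ (f ∘ suc)))

  sum-mono : ∀ {n} {f g : Fin n → ℤ} → (∀ j → f j ≤ g j) → sum f ≤ sum g
  sum-mono {zero} _ = ≤-refl
  sum-mono {suc n} f≤g = +-mono-≤ (f≤g zero) (sum-mono (f≤g ∘ suc))

  sum-nonneg : ∀ {n} {f : Fin n → ℤ} → (∀ j → 0ℤ ≤ f j) → 0ℤ ≤ sum f
  sum-nonneg {n} {f} f≥0 = subst (_≤ sum f) (sum-replicate-zero n) (sum-mono f≥0)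

  term≤sum : ∀ {n} {f : Fin n → ℤ} → (∀ j → 0ℤ ≤ f j) → ∀ j → f j ≤ sum f
  term≤sum {f = f} f≥0 zero = i≤i+j (f zero) _ {{nonNegative (sum-nonneg (f≥0 ∘ suc))}}
  term≤sum {f = f} f≥0 (suc j) =
    ≤-trans (term≤sum (f≥0 ∘ suc) j) (i≤j+i _ (f zero) {{nonNegative (f≥0 zero)}})

  term≤sumℕ : ∀ {n} (f : Fin n → ℕ) j → f j ℕ.≤ sumℕ f
  term≤sumℕ f zero = ℕP.m≤m+n (f zero) _
  term≤sumℕ f (suc j) = ℕP.≤-trans (term≤sumℕ (f ∘ suc) j) (ℕP.m≤n+m _ (f zero))

  i≤+∣i∣ : ∀ i → i ≤ + ∣ i ∣
  i≤+∣i∣ (+ n) = ≤-refl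
  i≤+∣i∣ -[1+ n ] = -≤+

  strict-upper-bound : ∀ {n} (f : Fin n → ℤ) → ∃ λ (N : ℕ) → ∀ j → f j < + N
  strict-upper-bound f = suc (sumℕ (λ j → ∣ f j ∣)) , λ j →
    ≤-<-trans (i≤+∣i∣ (f j)) (+<+ (ℕ.s≤s (term≤sumℕ (λ j → ∣ f j ∣) j)))

module Separation where

  open import Data.Nat as ℕ using (ℕ; zero; suc)
  import Data.Nat.Properties as ℕP
  open import Data.Integer
    using (ℤ; +_; -[1+_]; -_; _+_; _*_; _-_; _≤_; _≤?_; _≟_; 0ℤ; 1ℤ; -1ℤ; ∣_∣; +≤+; -≤-)
  open import Data.Integer.Properties
    using ( *-comm; *-zeroʳ; *-identityʳ; +-identityˡ; +-monoˡ-≤; +-mono-≤; ≤-trans; ≤-reflexive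
          ; ≤-refl; -1*i≡-i; *-monoˡ-≤-nonNeg; neg-mono-≤; ≰⇒>; i<j⇒i≤pred[j]; i<j⇒suc[i]≤j; pos-*; module ≤-Reasoning)
  open import Data.Integer.Tactic.RingSolver using (solve-∀)
  open import Data.Fin using (Fin; zero; suc)
  import Data.Fin.Properties as FinP
  open import Data.Vec.Functional using (_∷_)
  open import Data.Product using (∃; _×_; _,_)
  open import Function using (_∘_)
  open import Relation.Nullary using (yes; no; contradiction)
  open import Relation.Binary.PropositionalEquality
    using (_≡_; _≢_; refl; sym; trans; cong; cong₂; subst; module ≡-Reasoning)
  open FiniteSums

  private variable m d : ℕ

  _∙_ : (Fin m → ℤ) → (Fin m → ℤ) → ℤ
  y ∙ v = sum (λ k → y k * v k)

  ∙-comm : (y v : Fin m → ℤ) → y ∙ v ≡ v ∙ y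
  ∙-comm y v = sum-cong-≗ (λ k → *-comm (y k) (v k))

  lincomb : ℤ → (Fin m → ℤ) → ℤ → (Fin m → ℤ) → Fin m → ℤ
  lincomb α y β w k = α * y k + β * w k

  ∙-linearˡ : ∀ α β (y w v : Fin m → ℤ) → lincomb α y β w ∙ v ≡ α * (y ∙ v) + β * (w ∙ v)
  ∙-linearˡ α β y w v = begin
      sum (λ k → (α * y k + β * w k) * v k)
    ≡⟨ sum-cong-≗ (λ k → distrib α β (y k) (w k) (v k)) ⟩
      sum (λ k → α * (y k * v k) + β * (w k * v k))
    ≡⟨ ∑-distrib-+ (λ k → α * (y k * v k)) (λ k → β * (w k * v k)) ⟩
      sum (λ k → α * (y k * v k)) + sum (λ k → β * (w k * v k))
    ≡⟨ sym (cong₂ _+_ (*-distribˡ-sum α (λ k → y k * v k)) (*-distribˡ-sum β (λ k → w k * v k))) ⟩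
      α * (y ∙ v) + β * (w ∙ v) ∎
    where
    open ≡-Reasoning
    distrib : ∀ α β y w v → (α * y + β * w) * v ≡ α * (y * v) + β * (w * v)
    distrib = solve-∀

  ∙-linearʳ : ∀ α β (y w v : Fin m → ℤ) → v ∙ lincomb α y β w ≡ α * (v ∙ y) + β * (v ∙ w)
  ∙-linearʳ α β y w v = begin
      v ∙ lincomb α y β w       ≡⟨ ∙-comm v _ ⟩
      lincomb α y β w ∙ v       ≡⟨ ∙-linearˡ α β y w v ⟩
      α * (y ∙ v) + β * (w ∙ v) ≡⟨ cong₂ (λ s t → α * s + β * t) (∙-comm y v) (∙-comm w v) ⟩
      α * (v ∙ y) + β * (v ∙ w) ∎
    where open ≡-Reasoning

  0≤square : ∀ x → 0ℤ ≤ x * x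
  0≤square (+ zero) = +≤+ ℕ.z≤n
  0≤square (+ suc n) = +≤+ ℕ.z≤n
  0≤square -[1+ n ] = +≤+ ℕ.z≤n

  1≤square : ∀ {x} → x ≢ 0ℤ → 1ℤ ≤ x * x
  1≤square {+ zero} x≢0 = contradiction refl x≢0
  1≤square {+ suc n} _ = +≤+ (ℕ.s≤s ℕ.z≤n)
  1≤square { -[1+ n ]} _ = +≤+ (ℕ.s≤s ℕ.z≤n)

  combination : (Fin d → Fin m → ℤ) → (Fin d → ℕ) → Fin m → ℤ
  combination a l k = sum (λ j → a j k * + l j)

  Pointed : (Fin d → Fin m → ℤ) → Set
  Pointed a = ∀ l → (∀ k → combination a l k ≡ 0ℤ) → ∀ j → l j ≡ 0

  PositiveOn : (Fin m → ℤ) → (Fin d → Fin m → ℤ) → Set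
  PositiveOn y a = ∀ j → 1ℤ ≤ y ∙ a j

  pointed-tail : {a : Fin (suc d) → Fin m → ℤ} → Pointed a → Pointed (a ∘ suc)
  pointed-tail {a = a} a-pointed l l-null j = a-pointed (0 ∷ l) null (suc j)
    where
    null : ∀ k → combination a (0 ∷ l) k ≡ 0ℤ
    null k = trans (cong (_+ combination (a ∘ suc) l k) (*-zeroʳ (a zero k)))
                   (trans (+-identityˡ _) (l-null k))

  pointed⇒head-nonzero : {a : Fin (suc d) → Fin m → ℤ} → Pointed a → 1ℤ ≤ a zero ∙ a zero
  pointed⇒head-nonzero {d = d} {m = m} {a = a} a-pointed with FinP.all? (λ k → a zero k ≟ 0ℤ)
  ... | yes a₀≡0 = contradiction (a-pointed (1 ∷ λ _ → 0) null zero) λ ()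
    where
    null : ∀ k → combination a (1 ∷ λ _ → 0) k ≡ 0ℤ
    null k = cong₂ _+_ (trans (*-identityʳ (a zero k)) (a₀≡0 k))
                       (trans (sum-cong-≗ (λ j → *-zeroʳ (a (suc j) k))) (sum-replicate-zero d))
  ... | no a₀≢0 with FinP.¬∀⟶∃¬ m _ (λ k → a zero k ≟ 0ℤ) a₀≢0
  ... | k , a₀k≢0 = ≤-trans (1≤square a₀k≢0) (term≤sum (λ k → 0≤square (a zero k)) k)

  -- If y is positive on a₁,…,a_d but not on a₀ ≠ 0, subtracting a₀ from a large multiple
  -- of y gives a vector that is still positive on a₁,…,a_d and negative on a₀.
  tilt : (a : Fin (suc d) → Fin m → ℤ) (y : Fin m → ℤ) → 1ℤ ≤ a zero ∙ a zero →
         y ∙ a zero ≤ 0ℤ → PositiveOn y (a ∘ suc) →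
         ∃ λ y' → y' ∙ a zero ≤ -1ℤ × PositiveOn y' (a ∘ suc)
  tilt a y a₀≢0 y₀≤0 y₊ with strict-upper-bound (λ j → a zero ∙ a (suc j))
  ... | N , t<N = lincomb (+ N) y -1ℤ (a zero) , negative , positive
    where
    open ≤-Reasoning
    negative : lincomb (+ N) y -1ℤ (a zero) ∙ a zero ≤ -1ℤ
    negative = begin
        lincomb (+ N) y -1ℤ (a zero) ∙ a zero       ≡⟨ ∙-linearˡ (+ N) -1ℤ y (a zero) (a zero) ⟩
        + N * (y ∙ a zero) + -1ℤ * (a zero ∙ a zero) ≤⟨ +-mono-≤ Ny₀≤0 (≤-reflexive (-1*i≡-i (a zero ∙ a zero))) ⟩
        0ℤ + - (a zero ∙ a zero)                      ≤⟨ +-mono-≤ (≤-refl {0ℤ}) (neg-mono-≤ a₀≢0) ⟩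
        -1ℤ ∎
      where
      Ny₀≤0 : + N * (y ∙ a zero) ≤ 0ℤ
      Ny₀≤0 = ≤-trans (*-monoˡ-≤-nonNeg (+ N) y₀≤0) (≤-reflexive (*-zeroʳ (+ N)))
    positive : PositiveOn (lincomb (+ N) y -1ℤ (a zero)) (a ∘ suc)
    positive j = begin
        1ℤ                                ≡⟨ cancel t ⟩
        (1ℤ + t) + -1ℤ * t                ≤⟨ +-monoˡ-≤ (-1ℤ * t) (i<j⇒suc[i]≤j (t<N j)) ⟩
        + N + -1ℤ * t                     ≡⟨ cong (_+ -1ℤ * t) (sym (*-identityʳ (+ N))) ⟩
        + N * 1ℤ + -1ℤ * t                ≤⟨ +-monoˡ-≤ (-1ℤ * t) (*-monoˡ-≤-nonNeg (+ N) (y₊ j)) ⟩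
        + N * (y ∙ a (suc j)) + -1ℤ * t   ≡⟨ sym (∙-linearˡ (+ N) -1ℤ y (a zero) (a (suc j))) ⟩
        lincomb (+ N) y -1ℤ (a zero) ∙ a (suc j) ∎
      where
      t = a zero ∙ a (suc j)
      cancel : ∀ t → 1ℤ ≡ (1ℤ + t) + -1ℤ * t
      cancel = solve-∀

  recombine : ℕ → (Fin d → ℕ) → (Fin (suc d) → Fin m → ℤ) → Fin d → Fin m → ℤ
  recombine c P a j = lincomb (+ c) (a (suc j)) (+ P j) (a zero)

  recombine-combination : (c : ℕ) (P : Fin d → ℕ) (a : Fin (suc d) → Fin m → ℤ) (l : Fin d → ℕ) →
    ∀ k → combination (recombine c P a) l k
        ≡ combination a (sumℕ (λ j → P j ℕ.* l j) ∷ λ j → c ℕ.* l j) k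
  recombine-combination c P a l k = begin
      sum (λ j → (+ c * a (suc j) k + + P j * a zero k) * + l j)
    ≡⟨ sum-cong-≗ (λ j → termwise (a (suc j) k) (P j) (l j)) ⟩
      sum (λ j → a zero k * + (P j ℕ.* l j) + a (suc j) k * + (c ℕ.* l j))
    ≡⟨ ∑-distrib-+ (λ j → a zero k * + (P j ℕ.* l j)) (λ j → a (suc j) k * + (c ℕ.* l j)) ⟩
      sum (λ j → a zero k * + (P j ℕ.* l j)) + sum (λ j → a (suc j) k * + (c ℕ.* l j))
    ≡⟨ cong (_+ sum (λ j → a (suc j) k * + (c ℕ.* l j))) (sym (*-distribˡ-sum (a zero k) (λ j → + (P j ℕ.* l j)))) ⟩
      a zero k * sum (λ j → + (P j ℕ.* l j)) + sum (λ j → a (suc j) k * + (c ℕ.* l j))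
    ≡⟨ cong (λ s → a zero k * s + sum (λ j → a (suc j) k * + (c ℕ.* l j))) (sym (+-sumℕ (λ j → P j ℕ.* l j))) ⟩
      a zero k * + sumℕ (λ j → P j ℕ.* l j) + sum (λ j → a (suc j) k * + (c ℕ.* l j)) ∎
    where
    open ≡-Reasoning
    reassoc : ∀ c x p z l → (c * x + p * z) * l ≡ z * (p * l) + x * (c * l)
    reassoc = solve-∀
    termwise : ∀ x p l → (+ c * x + + p * a zero k) * + l ≡ a zero k * + (p ℕ.* l) + x * + (c ℕ.* l)
    termwise x p l = trans (reassoc (+ c) x (+ p) (a zero k) (+ l))
      (sym (cong₂ (λ s t → a zero k * s + x * t) (pos-* p l) (pos-* c l)))

  pointed-recombine : {a : Fin (suc d) → Fin m → ℤ} (c : ℕ) (P : Fin d → ℕ) →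
    (∀ j → 1 ℕ.≤ P j) → Pointed a → Pointed (recombine c P a)
  pointed-recombine {a = a} c P P≥1 a-pointed l l-null j = ℕP.n≤0⇒n≡0 (begin
      l j                        ≤⟨ ℕP.m≤n*m (l j) (P j) {{ℕ.>-nonZero (P≥1 j)}} ⟩
      P j ℕ.* l j                ≤⟨ term≤sumℕ (λ j → P j ℕ.* l j) j ⟩
      sumℕ (λ j → P j ℕ.* l j)   ≡⟨ a-pointed Λ Λ-null zero ⟩
      0 ∎)
    where
    open ℕP.≤-Reasoning
    Λ : Fin (suc _) → ℕ
    Λ = sumℕ (λ j → P j ℕ.* l j) ∷ λ j → c ℕ.* l j
    Λ-null : ∀ k → combination a Λ k ≡ 0ℤ
    Λ-null k = trans (sym (recombine-combination c P a l k)) (l-null k)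

  +∣∣-of-positive : ∀ {x} → 1ℤ ≤ x → + ∣ x ∣ ≡ x
  +∣∣-of-positive (+≤+ _) = refl

  +∣∣-of-negative : ∀ {x} → x ≤ -1ℤ → + ∣ x ∣ ≡ - x
  +∣∣-of-negative (-≤- _) = refl

  ∣∣-of-positive : ∀ {x} → 1ℤ ≤ x → 1 ℕ.≤ ∣ x ∣
  ∣∣-of-positive (+≤+ 1≤n) = 1≤n

  -- Let y be negative on a₀ and positive on a₁,…,a_d, and let
  -- y' be positive on the family recombined with c = -(y·a₀) and Pⱼ = y·aⱼ₊₁.  For N larger
  -- than every Pⱼ, z = N·c·y' + (N·(y'·a₀) - 1)·y is positive on the whole family: z·a₀ = c
  -- and z·aⱼ₊₁ = N·(y'·(c·aⱼ₊₁ + Pⱼ·a₀)) - Pⱼ ≥ N - Pⱼ.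
  combine-separators : (a : Fin (suc d) → Fin m → ℤ) (y y' : Fin m → ℤ) →
    y ∙ a zero ≤ -1ℤ → PositiveOn y (a ∘ suc) →
    PositiveOn y' (recombine ∣ y ∙ a zero ∣ (λ j → ∣ y ∙ a (suc j) ∣) a) →
    ∃ λ z → PositiveOn z a
  combine-separators a y y' y₀<0 y₊ y'₊ with strict-upper-bound (λ j → y ∙ a (suc j))
  ... | N , P<N = z , λ { zero → z₀ ; (suc j) → zⱼ j }
    where
    open ≤-Reasoning
    p q : ℤ
    p = y ∙ a zero
    q = y' ∙ a zero
    α β : ℤ
    α = + N * - p
    β = + N * q - 1ℤ
    z : Fin _ → ℤ
    z = lincomb α y' β y

    z₀ : 1ℤ ≤ z ∙ a zero
    z₀ = begin
        1ℤ             ≤⟨ neg-mono-≤ y₀<0 ⟩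
        - p            ≡⟨ value (+ N) p q ⟩
        α * q + β * p  ≡⟨ sym (∙-linearˡ α β y' y (a zero)) ⟩
        z ∙ a zero     ∎
      where
      value : ∀ N p q → - p ≡ (N * - p) * q + (N * q - 1ℤ) * p
      value = solve-∀

    y'-recombined : ∀ j → 1ℤ ≤ - p * (y' ∙ a (suc j)) + (y ∙ a (suc j)) * q
    y'-recombined j = subst (1ℤ ≤_)
      (trans (∙-linearʳ (+ ∣ p ∣) (+ ∣ y ∙ a (suc j) ∣) (a (suc j)) (a zero) y')
             (cong₂ (λ c P → c * (y' ∙ a (suc j)) + P * q)
                    (+∣∣-of-negative y₀<0) (+∣∣-of-positive (y₊ j))))
      (y'₊ j)

    zⱼ : ∀ j → 1ℤ ≤ z ∙ a (suc j)
    zⱼ j = begin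
        1ℤ                                   ≡⟨ cancel P ⟩
        (1ℤ + P) - P                         ≤⟨ +-monoˡ-≤ (- P) (i<j⇒suc[i]≤j (P<N j)) ⟩
        + N - P                              ≡⟨ cong (_- P) (sym (*-identityʳ (+ N))) ⟩
        + N * 1ℤ - P                         ≤⟨ +-monoˡ-≤ (- P) (*-monoˡ-≤-nonNeg (+ N) (y'-recombined j)) ⟩
        + N * (- p * s + P * q) - P          ≡⟨ value (+ N) p q s P ⟩
        α * s + β * P                        ≡⟨ sym (∙-linearˡ α β y' y (a (suc j))) ⟩
        z ∙ a (suc j)                        ∎
      where
      P s : ℤ
      P = y ∙ a (suc j)
      s = y' ∙ a (suc j)
      cancel : ∀ P → 1ℤ ≡ (1ℤ + P) - P
      cancel = solve-∀
      value : ∀ N p q s P → N * (- p * s + P * q) - P ≡ (N * - p) * s + (N * q - 1ℤ) * P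
      value = solve-∀

  -- By induction on the size, take y positive on
  -- a₁,…,a_d.  If y·a₀ ≥ 1 we are done.  Otherwise tilt y until it is negative on a₀, apply
  -- the induction hypothesis to the recombined family, and combine the two separators.
  gordan : ∀ d (a : Fin d → Fin m → ℤ) → Pointed a → ∃ λ y → PositiveOn y a
  gordan zero a _ = (λ _ → 0ℤ) , λ ()
  gordan (suc d) a a-pointed with gordan d (a ∘ suc) (pointed-tail {a = a} a-pointed)
  ... | y , y₊ with 1ℤ ≤? y ∙ a zero
  ...   | yes y₀₊ = y , λ { zero → y₀₊ ; (suc j) → y₊ j }
  ...   | no y₀≰1 with tilt a y (pointed⇒head-nonzero {a = a} a-pointed) (i<j⇒i≤pred[j] (≰⇒> y₀≰1)) y₊
  ...     | y* , y*₀<0 , y*₊ with gordan d (recombine c P a) (pointed-recombine {a = a} c P P≥1 a-pointed)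
    where
    c : ℕ
    c = ∣ y* ∙ a zero ∣
    P : Fin d → ℕ
    P j = ∣ y* ∙ a (suc j) ∣
    P≥1 : ∀ j → 1 ℕ.≤ P j
    P≥1 j = ∣∣-of-positive (y*₊ j)
  ...       | y' , y'₊ = combine-separators a y* y' y*₀<0 y*₊ y'₊

module Fibers where

  open import Data.Nat as ℕ using (ℕ)
  open import Data.Integer using (ℤ; +_; _*_; _≤_; ∣_∣; +≤+; drop‿+≤+)
  open import Data.Integer.Properties
    using (*-assoc; *-identityˡ; *-monoʳ-≤-nonNeg; ≤-trans; ≤-reflexive; ∣i*j∣≡∣i∣*∣j∣; module ≤-Reasoning)
  import Data.Nat.Properties as ℕP
  open import Data.Fin using (Fin)
  open import Data.Vec using (Vec; lookup; tabulate)
  open import Data.Vec.Properties using (lookup∘tabulate)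
  open import Relation.Binary.PropositionalEquality using (_≡_; sym; trans; cong; subst)
  open FiniteSums
  open Separation

  column : ∀ {m d} → Matrix m d → Fin d → Fin m → ℤ
  column A j k = A k j

  ·≡combination : ∀ {m d} (A : Matrix m d) (u : Vec ℕ d) →
    ∀ k → (A · u) k ≡ combination (column A) (lookup u) k
  ·≡combination A u k = sumℤ≡sum (λ j → A k j * + lookup u j)

  pointedKernel⇒pointed : ∀ {m d} {A : Matrix m d} → PointedKernel A → Pointed (column A)
  pointedKernel⇒pointed {A = A} A-pointed l l-null j =
    trans (sym (lookup∘tabulate l j)) (A-pointed (tabulate l) null j)
    where
    null : ∀ k → (A · tabulate l) k ≡ + 0
    null k = trans (·≡combination A (tabulate l) k)
      (trans (sum-cong-≗ (λ j → cong (λ x → A k j * + x) (lookup∘tabulate l j))) (l-null k))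

  -- If y is positive on the columns of A, each coordinate of a solution of Au = b is at
  -- most y·b, since y·b = y·(Au) = Σⱼ (y·Aⱼ) uⱼ ≥ Σⱼ uⱼ.
  coordinate≤dot : ∀ {m d} (A : Matrix m d) (y : Fin m → ℤ) → PositiveOn y (column A) →
    ∀ {b u} → InFiber A b u → ∀ j → + lookup u j ≤ y ∙ b
  coordinate≤dot A y y₊ {b} {u} Au≡b j = begin
      + lookup u j                                   ≤⟨ term≤sum (λ j → +≤+ ℕ.z≤n) j ⟩
      sum (λ j → + lookup u j)                       ≤⟨ sum-mono weighted ⟩
      sum (λ j → (y ∙ column A j) * + lookup u j)    ≡⟨ regroup ⟩
      y ∙ (A · u)                                    ≡⟨ sum-cong-≗ (λ k → cong (y k *_) (Au≡b k)) ⟩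
      y ∙ b                                          ∎
    where
    open ≤-Reasoning
    U : Fin _ → ℤ
    U j = + lookup u j
    weighted : ∀ j → U j ≤ (y ∙ column A j) * U j
    weighted j = ≤-trans (≤-reflexive (sym (*-identityˡ (U j)))) (*-monoʳ-≤-nonNeg (U j) (y₊ j))
    regroup : sum (λ j → (y ∙ column A j) * U j) ≡ y ∙ (A · u)
    regroup = begin-equality
        sum (λ j → sum (λ k → y k * A k j) * U j)    ≡⟨ sum-cong-≗ (λ j → *-distribʳ-sum (U j) (λ k → y k * A k j)) ⟩
        sum (λ j → sum (λ k → y k * A k j * U j))    ≡⟨ ∑-comm (λ j k → y k * A k j * U j) ⟩
        sum (λ k → sum (λ j → y k * A k j * U j))    ≡⟨ sum-cong-≗ (λ k → sum-cong-≗ (λ j → *-assoc (y k) (A k j) (U j))) ⟩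
        sum (λ k → sum (λ j → y k * (A k j * U j)))  ≡⟨ sum-cong-≗ (λ k → sym (*-distribˡ-sum (y k) (λ j → A k j * U j))) ⟩
        sum (λ k → y k * sum (λ j → A k j * U j))    ≡⟨ sum-cong-≗ (λ k → cong (y k *_) (sym (sumℤ≡sum (λ j → A k j * U j)))) ⟩
        y ∙ (A · u)                                  ∎

  dot≤ : ∀ {m} (y b : Fin m → ℤ) (B : ℕ) → (∀ k → ∣ b k ∣ ℕ.≤ B) →
    y ∙ b ≤ + (sumℕ (λ k → ∣ y k ∣) ℕ.* B)
  dot≤ y b B b≤B = begin
      sum (λ k → y k * b k)                ≤⟨ sum-mono termwise ⟩
      sum (λ k → + (∣ y k ∣ ℕ.* B))        ≡⟨ sym (+-sumℕ (λ k → ∣ y k ∣ ℕ.* B)) ⟩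
      + sumℕ (λ k → ∣ y k ∣ ℕ.* B)         ≡⟨ cong +_ (sym (*-distribʳ-sumℕ B (λ k → ∣ y k ∣))) ⟩
      + (sumℕ (λ k → ∣ y k ∣) ℕ.* B)       ∎
    where
    open ≤-Reasoning
    termwise : ∀ k → y k * b k ≤ + (∣ y k ∣ ℕ.* B)
    termwise k = ≤-trans (i≤+∣i∣ (y k * b k))
      (subst (λ n → + n ≤ + (∣ y k ∣ ℕ.* B)) (sym (∣i*j∣≡∣i∣*∣j∣ (y k) (b k)))
             (+≤+ (ℕP.*-monoʳ-≤ ∣ y k ∣ (b≤B k))))

  fiber-bounded : ∀ {m d} (A : Matrix m d) (y : Fin m → ℤ) → PositiveOn y (column A) →
    ∀ {b} (B : ℕ) → (∀ k → ∣ b k ∣ ℕ.≤ B) →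
    ∀ {u} → InFiber A b u → ∀ j → lookup u j ℕ.≤ sumℕ (λ k → ∣ y k ∣) ℕ.* B
  fiber-bounded A y y₊ {b} B b≤B {u} Au≡b j =
    drop‿+≤+ (≤-trans (coordinate≤dot A y y₊ {b} {u} Au≡b j) (dot≤ y b B b≤B))

module Counting where

  open import Data.Nat using (ℕ; suc; _≤_; _^_; s≤s)
  open import Data.Fin using (Fin; zero; suc; toℕ; fromℕ<; funToFin; finToFun)
  import Data.Fin.Properties as FinP
  open import Data.Vec using (Vec; lookup; tabulate)
  open import Data.Vec.Properties using (tabulate∘lookup; tabulate-cong)
  open import Data.List as List using (List; length)
  open import Data.List.Relation.Unary.All as All using (All)
  open import Data.List.Relation.Unary.AllPairs using (_∷_)
  open import Data.List.Relation.Unary.Unique.Propositional using (Unique)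
  open import Data.List.Membership.Propositional.Properties using (∈-lookup)
  open import Relation.Nullary using (contradiction)
  open import Relation.Binary.PropositionalEquality
    using (_≡_; refl; sym; cong; module ≡-Reasoning)

  unique⇒lookup-injective : ∀ {A : Set} {xs : List A} → Unique xs →
    ∀ i j → List.lookup xs i ≡ List.lookup xs j → i ≡ j
  unique⇒lookup-injective (_ ∷ _) zero zero _ = refl
  unique⇒lookup-injective (x∉ ∷ _) zero (suc j) eq = contradiction eq (All.lookup x∉ (∈-lookup j))
  unique⇒lookup-injective (x∉ ∷ _) (suc i) zero eq = contradiction (sym eq) (All.lookup x∉ (∈-lookup i))
  unique⇒lookup-injective (_ ∷ uniq) (suc i) (suc j) eq = cong suc (unique⇒lookup-injective uniq i j eq)

  unique-length≤ : ∀ {A : Set} {P : A → Set} {n} (encode : ∀ {x} → P x → Fin n) →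
    (∀ {x y} (px : P x) (py : P y) → encode px ≡ encode py → x ≡ y) →
    ∀ {xs} → Unique xs → All P xs → length xs ≤ n
  unique-length≤ encode encode-injective {xs} uniq all = FinP.injective⇒≤ {f = f} f-injective
    where
    f : Fin (length xs) → Fin _
    f i = encode (All.lookup all (∈-lookup i))
    f-injective : ∀ {i j} → f i ≡ f j → i ≡ j
    f-injective {i} {j} eq = unique⇒lookup-injective uniq i j (encode-injective _ _ eq)

  Bounded : ∀ {d} → ℕ → Vec ℕ d → Set
  Bounded N u = ∀ j → lookup u j ≤ N

  -- A bounded vector, read as the digits of a number in base N + 1.
  digits : ∀ {d N} (u : Vec ℕ d) → Bounded N u → Fin (suc N ^ d)
  digits u u≤N = funToFin (λ j → fromℕ< (s≤s (u≤N j)))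

  digits-injective : ∀ {d N} {u v : Vec ℕ d} (u≤N : Bounded N u) (v≤N : Bounded N v) →
    digits u u≤N ≡ digits v v≤N → u ≡ v
  digits-injective {u = u} {v} u≤N v≤N eq = begin
      u                   ≡⟨ sym (tabulate∘lookup u) ⟩
      tabulate (lookup u) ≡⟨ tabulate-cong same-entry ⟩
      tabulate (lookup v) ≡⟨ tabulate∘lookup v ⟩
      v                   ∎
    where
    open ≡-Reasoning
    same-entry : ∀ j → lookup u j ≡ lookup v j
    same-entry j = begin
        lookup u j                      ≡⟨ sym (FinP.toℕ-fromℕ< (s≤s (u≤N j))) ⟩
        toℕ (fromℕ< (s≤s (u≤N j)))      ≡⟨ cong toℕ (sym (FinP.finToFun-funToFin _ j)) ⟩
        toℕ (finToFun (digits u u≤N) j) ≡⟨ cong (λ c → toℕ (finToFun c j)) eq ⟩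
        toℕ (finToFun (digits v v≤N) j) ≡⟨ cong toℕ (FinP.finToFun-funToFin _ j) ⟩
        toℕ (fromℕ< (s≤s (v≤N j)))      ≡⟨ FinP.toℕ-fromℕ< (s≤s (v≤N j)) ⟩
        lookup v j                      ∎

  count-bounded : ∀ {d} N {us : List (Vec ℕ d)} → Unique us → All (Bounded N) us → length us ≤ suc N ^ d
  count-bounded N = unique-length≤ (λ {u} → digits u) digits-injective

module Growth where

  open import Data.Nat
  open import Data.Nat.Properties
  open import Data.Nat.Tactic.RingSolver using (solve-∀)
  open import Data.Fin using (Fin; toℕ; fromℕ<)
  open import Data.Fin.Properties using (toℕ-fromℕ<)
  open import Data.Product using (∃; _,_)
  open import Relation.Nullary using (yes; no)
  open import Relation.Binary.PropositionalEquality
  open FiniteSums using (sumℕ; term≤sumℕ)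

  -- Natural numbers bounded by g i from the index i₀ on are bounded by g i + M for all i,
  -- where M sums up the finitely many values before i₀.
  eventually-bounded : ∀ {m} (f : ℕ → Fin m → ℕ) (g : ℕ → ℕ) (i₀ : ℕ) →
    (∀ i → i₀ ≤ i → ∀ k → f i k ≤ g i) → ∃ λ M → ∀ i k → f i k ≤ g i + M
  eventually-bounded f g i₀ f≤g = M , bound
    where
    row : ℕ → ℕ
    row i = sumℕ (f i)
    M : ℕ
    M = sumℕ (λ (i : Fin i₀) → row (toℕ i))
    bound : ∀ i k → f i k ≤ g i + M
    bound i k with i₀ ≤? i
    ... | yes i₀≤i = ≤-trans (f≤g i i₀≤i k) (m≤m+n (g i) M)
    ... | no i₀≰i = begin
        f i k                    ≤⟨ term≤sumℕ (f i) k ⟩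
        row i                    ≡⟨ cong row (sym (toℕ-fromℕ< i<i₀)) ⟩
        row (toℕ (fromℕ< i<i₀))  ≤⟨ term≤sumℕ (λ (i : Fin i₀) → row (toℕ i)) (fromℕ< i<i₀) ⟩
        M                        ≤⟨ m≤n+m M (g i) ⟩
        g i + M                  ∎
      where
      open ≤-Reasoning
      i<i₀ : i < i₀
      i<i₀ = ≰⇒> i₀≰i

  ^-distribʳ-* : ∀ a b n → (a * b) ^ n ≡ a ^ n * b ^ n
  ^-distribʳ-* a b zero = refl
  ^-distribʳ-* a b (suc n) = trans (cong (a * b *_) (^-distribʳ-* a b n)) (interchange a b (a ^ n) (b ^ n))
    where
    interchange : ∀ a b x y → a * b * (x * y) ≡ a * x * (b * y)
    interchange = solve-∀

  -- A bound of the form 1 + Y(C iʳ + M), raised to the d-th power, grows at most like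
  -- K (1 + i)^{rd}: each of iʳ and 1 is at most (1 + i)ʳ.
  growth : ∀ Y C M r d i → suc (Y * (C * i ^ r + M)) ^ d ≤ suc (Y * C + Y * M) ^ d * suc i ^ (r * d)
  growth Y C M r d i = begin
      suc (Y * (C * i ^ r + M)) ^ d            ≤⟨ ^-monoˡ-≤ d base ⟩
      (suc (Y * C + Y * M) * P) ^ d            ≡⟨ ^-distribʳ-* (suc (Y * C + Y * M)) P d ⟩
      suc (Y * C + Y * M) ^ d * P ^ d          ≡⟨ cong (suc (Y * C + Y * M) ^ d *_) (^-*-assoc (suc i) r d) ⟩
      suc (Y * C + Y * M) ^ d * suc i ^ (r * d) ∎
    where
    open ≤-Reasoning
    P : ℕ
    P = suc i ^ r
    iʳ≤P : i ^ r ≤ P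
    iʳ≤P = ^-monoˡ-≤ r (n≤1+n i)
    1≤P : 1 ≤ P
    1≤P = m^n>0 (suc i) r
    expand : ∀ Y C M x → suc (Y * (C * x + M)) ≡ 1 + Y * C * x + Y * M * 1
    expand = solve-∀
    factor : ∀ Y C M P → P + Y * C * P + Y * M * P ≡ suc (Y * C + Y * M) * P
    factor = solve-∀
    base : suc (Y * (C * i ^ r + M)) ≤ suc (Y * C + Y * M) * P
    base = begin
        suc (Y * (C * i ^ r + M))           ≡⟨ expand Y C M (i ^ r) ⟩
        1 + Y * C * i ^ r + Y * M * 1       ≤⟨ +-mono-≤ (+-mono-≤ 1≤P (*-monoʳ-≤ (Y * C) iʳ≤P)) (*-monoʳ-≤ (Y * M) 1≤P) ⟩
        P + Y * C * P + Y * M * P           ≡⟨ factor Y C M P ⟩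
        suc (Y * C + Y * M) * P             ∎

module Polynomials where

  open import Data.Nat using (ℕ; zero; suc; _+_; _*_; _^_; _≤_)
  open import Data.Nat.Properties using (+-identityʳ)
  open import Data.Nat.Tactic.RingSolver using (solve-∀)
  open import Data.Integer as ℤ using (+_)
  import Data.Integer.Properties as ℤP
  open import Data.Rational as ℚ using (mkℚ; _/_)
  import Data.Rational.Properties as ℚP
  import Data.Nat.Coprimality as Coprimality
  open import Data.List using (List; []; _∷_; map)
  open import Relation.Binary.PropositionalEquality

  ℕ→ℚ-normal : ∀ n → ℕ→ℚ n ≡ mkℚ (+ n) 0 (Coprimality.sym (Coprimality.1-coprimeTo n))
  ℕ→ℚ-normal n = ℚP.normalize-coprime (Coprimality.sym (Coprimality.1-coprimeTo n))

  ℕ→ℚ-+ : ∀ a b → ℕ→ℚ a ℚ.+ ℕ→ℚ b ≡ ℕ→ℚ (a + b)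
  ℕ→ℚ-+ a b = trans (cong₂ ℚ._+_ (ℕ→ℚ-normal a) (ℕ→ℚ-normal b))
    (cong (_/ 1) (trans (cong₂ ℤ._+_ (ℤP.*-identityʳ (+ a)) (ℤP.*-identityʳ (+ b))) (sym (ℤP.pos-+ a b))))

  ℕ→ℚ-* : ∀ a b → ℕ→ℚ a ℚ.* ℕ→ℚ b ≡ ℕ→ℚ (a * b)
  ℕ→ℚ-* a b = trans (cong₂ ℚ._*_ (ℕ→ℚ-normal a) (ℕ→ℚ-normal b)) (cong (_/ 1) (sym (ℤP.pos-* a b)))

  ℕ→ℚ-mono : ∀ {a b} → a ≤ b → ℕ→ℚ a ℚ.≤ ℕ→ℚ b
  ℕ→ℚ-mono {a} {b} a≤b = subst₂ ℚ._≤_ (sym (ℕ→ℚ-normal a)) (sym (ℕ→ℚ-normal b))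
    (ℚ.*≤* (subst₂ ℤ._≤_ (sym (ℤP.*-identityʳ (+ a))) (sym (ℤP.*-identityʳ (+ b))) (ℤ.+≤+ a≤b)))

  evalℕ : List ℕ → ℕ → ℕ
  evalℕ [] x = 0
  evalℕ (c ∷ cs) x = c + x * evalℕ cs x

  eval-map-ℕ→ℚ : ∀ p x → eval (map ℕ→ℚ p) (ℕ→ℚ x) ≡ ℕ→ℚ (evalℕ p x)
  eval-map-ℕ→ℚ [] x = refl
  eval-map-ℕ→ℚ (c ∷ p) x = begin
      ℕ→ℚ c ℚ.+ ℕ→ℚ x ℚ.* eval (map ℕ→ℚ p) (ℕ→ℚ x) ≡⟨ cong (λ v → ℕ→ℚ c ℚ.+ ℕ→ℚ x ℚ.* v) (eval-map-ℕ→ℚ p x) ⟩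
      ℕ→ℚ c ℚ.+ ℕ→ℚ x ℚ.* ℕ→ℚ (evalℕ p x)           ≡⟨ cong (ℕ→ℚ c ℚ.+_) (ℕ→ℚ-* x (evalℕ p x)) ⟩
      ℕ→ℚ c ℚ.+ ℕ→ℚ (x * evalℕ p x)                 ≡⟨ ℕ→ℚ-+ c (x * evalℕ p x) ⟩
      ℕ→ℚ (c + x * evalℕ p x)                       ∎
    where open ≡-Reasoning

  _⊕_ : List ℕ → List ℕ → List ℕ
  [] ⊕ q = q
  (a ∷ p) ⊕ [] = a ∷ p
  (a ∷ p) ⊕ (b ∷ q) = (a + b) ∷ (p ⊕ q)

  evalℕ-⊕ : ∀ p q x → evalℕ (p ⊕ q) x ≡ evalℕ p x + evalℕ q x
  evalℕ-⊕ [] q x = refl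
  evalℕ-⊕ (a ∷ p) [] x = sym (+-identityʳ _)
  evalℕ-⊕ (a ∷ p) (b ∷ q) x =
    trans (cong (λ v → a + b + x * v) (evalℕ-⊕ p q x)) (regroup a b x (evalℕ p x) (evalℕ q x))
    where
    regroup : ∀ a b x u v → a + b + x * (u + v) ≡ (a + x * u) + (b + x * v)
    regroup = solve-∀

  -- The coefficients of K·(1 + t)^e, via (1 + t)·p = p + t·p.
  scaledPower : ℕ → ℕ → List ℕ
  scaledPower K zero = K ∷ []
  scaledPower K (suc e) = scaledPower K e ⊕ (0 ∷ scaledPower K e)

  evalℕ-scaledPower : ∀ K e x → evalℕ (scaledPower K e) x ≡ K * suc x ^ e
  evalℕ-scaledPower K zero x = constant K x
    where
    constant : ∀ K x → K + x * 0 ≡ K * 1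
    constant = solve-∀
  evalℕ-scaledPower K (suc e) x = begin
      evalℕ (scaledPower K e ⊕ (0 ∷ scaledPower K e)) x  ≡⟨ evalℕ-⊕ (scaledPower K e) (0 ∷ scaledPower K e) x ⟩
      V + (0 + x * V)                                    ≡⟨ cong (λ v → v + (0 + x * v)) (evalℕ-scaledPower K e x) ⟩
      K * suc x ^ e + (0 + x * (K * suc x ^ e))          ≡⟨ step K x (suc x ^ e) ⟩
      K * suc x ^ suc e                                  ∎
    where
    open ≡-Reasoning
    V : ℕ
    V = evalℕ (scaledPower K e) x
    step : ∀ K x P → K * P + (0 + x * (K * P)) ≡ K * ((1 + x) * P)
    step = solve-∀

  binomialPoly : ℕ → ℕ → Poly
  binomialPoly K e = map ℕ→ℚ (scaledPower K e)

  below-binomialPoly : ∀ K e i n → n ≤ K * suc i ^ e → ℕ→ℚ n ℚ.≤ eval (binomialPoly K e) (ℕ→ℚ i)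
  below-binomialPoly K e i n n≤ = subst (ℕ→ℚ n ℚ.≤_)
    (sym (trans (eval-map-ℕ→ℚ (scaledPower K e) i) (cong ℕ→ℚ (evalℕ-scaledPower K e i))))
    (ℕ→ℚ-mono n≤)

open import Data.Nat using (ℕ; _≤_; _*_; _^_; _>_)
open import Data.Integer using (ℤ; ∣_∣)
open import Data.Fin using (Fin)
open import Data.Vec using (Vec)
open import Data.List using (List; length)
open import Data.List.Relation.Unary.All using (All)
open import Data.List.Relation.Unary.Unique.Propositional using (Unique)
open import Data.Product using (Σ; ∃; _×_)
open import Data.Rational as ℚ using (ℚ)

open import Data.Nat using (suc; _+_)
import Data.List.Relation.Unary.All as All
open import Data.Product using (_,_)
open import Data.Nat.Properties using (module ≤-Reasoning)
open FiniteSums using (sumℕ)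
open Separation using (gordan)
open Counting using (Bounded; count-bounded)
open Fibers using (column; pointedKernel⇒pointed; fiber-bounded)
open Growth using (eventually-bounded; growth)
open Polynomials using (binomialPoly; below-binomialPoly)

proposition3p19 : (m d : ℕ) (A : Matrix m d) → PointedKernel A →
    (b : ℕ → Fin m → ℤ) → (∀ i → InSemigroup A (b i)) →
    (∃ λ (r : ℕ) → ∃ λ (C : ℕ) → ∃ λ (i₀ : ℕ) →
      C > 0 × (∀ i → i₀ ≤ i → ∀ k → ∣ b i k ∣ ≤ C * i ^ r)) →
    ∃ λ (q : Poly) → ∀ (i : ℕ) (us : List (Vec ℕ d)) →
      Unique us → All (InFiber A (b i)) us →
      ℕ→ℚ (length us) ℚ.≤ eval q (ℕ→ℚ i)
proposition3p19 m d A A-pointed b _ (r , C , i₀ , _ , b-growth)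
  with gordan d (column A) (pointedKernel⇒pointed {A = A} A-pointed)
     | eventually-bounded (λ i k → ∣ b i k ∣) (λ i → C * i ^ r) i₀ b-growth
... | y , y₊ | M , b≤ = binomialPoly K (r * d) , fibers-bounded
  where
  Y K : ℕ
  Y = sumℕ (λ k → ∣ y k ∣)
  K = suc (Y * C + Y * M) ^ d
  fibers-bounded : ∀ i us → Unique us → All (InFiber A (b i)) us →
    ℕ→ℚ (length us) ℚ.≤ eval (binomialPoly K (r * d)) (ℕ→ℚ i)
  fibers-bounded i us distinct in-fiber = below-binomialPoly K (r * d) i (length us) (begin
      length us            ≤⟨ count-bounded (Y * B) distinct (All.map (λ {u} → coordinates≤ {u}) in-fiber) ⟩
      suc (Y * B) ^ d      ≤⟨ growth Y C M r d i ⟩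
      K * suc i ^ (r * d)  ∎)
    where
    open ≤-Reasoning
    B : ℕ
    B = C * i ^ r + M
    coordinates≤ : ∀ {u} → InFiber A (b i) u → Bounded (Y * B) u
    coordinates≤ {u} = fiber-bounded A y y₊ B (b≤ i) {u}
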